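{- For any integers $1\le m<n$ and positive integer $r$, \[\mathbb{E}_{\mathfrak{S}_{n,r}}[X_{m+1}\cdots X_n]=\left(\frac{r-1}{r}\right)^{n-m}\cdot\frac{1}{(n-m)!}.\]
   Context: $\mathfrak{S}_{n,r}$ is the set of pairs $(\omega,\tau)$, $\omega\in\mathfrak{S}_n$, $\tau:[n]\to\mathbb{Z}_r$ (colors $0,\ldots,r-1$). Order symbols $i^c$ by $1^0<\cdots<n^0<1^1<\cdots<n^1<\cdots<1^{r-1}<\cdots<n^{r-1}$. An index $i\in[n]$ is a descent of $(\omega,\tau)$ if $\omega(i)^{\tau(i)}>\omega(i+1)^{\tau(i+1)}$, with the convention $\omega(n+1)=n+1$, $\tau(n+1)=0$. $X_i$ is the indicator that $i$ is a descent. Expectation is with respect to the uniform distribution on $\mathfrak{S}_{n,r}$. -}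

module Defs where

open import Data.Nat using (ℕ; zero; suc; _+_; _∸_; _<_; _<?_; _≤?_)
open import Data.Nat.Properties using (<-cmp)
open import Data.Fin using (Fin; toℕ; fromℕ<)
open import Data.Fin.Properties using (all?) renaming (_≟_ to _≟ᶠ_)
open import Data.Vec.Functional using () renaming (_∷_ to _∷ᶠ_)
open import Data.List using (List; []; _∷_; map; concatMap; filter; length; allFin; upTo)
open import Data.Nat.ListAction using (sum; product)
open import Data.Product using (_×_; _,_; Σ)
open import Data.Sum using (_⊎_)
open import Data.Integer using (+_)
open import Data.Rational using (ℚ; 0ℚ; 1ℚ; _/_; _*_)
open import Relation.Binary.PropositionalEquality using (_≡_)
open import Relation.Nullary using (Dec; yes; no; does)
open import Relation.Nullary.Decidable using (_×-dec_; _⊎-dec_; _→-dec_)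
open import Data.Nat using (_≟_)

_^ℚ_ : ℚ → ℕ → ℚ
q ^ℚ zero  = 1ℚ
q ^ℚ suc k = q * (q ^ℚ k)

allFuns : ∀ n k → List (Fin n → Fin k)
allFuns zero    k = (λ ()) ∷ []
allFuns (suc n) k = concatMap (λ i → map (λ f → i ∷ᶠ f) (allFuns n k)) (allFin k)

-- ω ∈ 𝔖_n : a bijection [n] → [n], i.e. an injective self-map of Fin n
IsPerm : ∀ {n} → (Fin n → Fin n) → Set
IsPerm {n} ω = ∀ i j → ω i ≡ ω j → i ≡ j

isPerm? : ∀ {n} (ω : Fin n → Fin n) → Dec (IsPerm ω)
isPerm? ω = all? (λ i → all? (λ j → (ω i ≟ᶠ ω j) →-dec (i ≟ᶠ j)))

allPerms : ∀ n → List (Fin n → Fin n)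
allPerms n = filter isPerm? (allFuns n n)

-- colored permutations (ω , τ), τ : [n] → ℤ_r  (colors 0 … r-1)
ColPerm : ℕ → ℕ → Set
ColPerm n r = (Fin n → Fin n) × (Fin n → Fin r)

allColPerms : ∀ n r → List (ColPerm n r)
allColPerms n r = concatMap (λ ω → map (λ τ → (ω , τ)) (allFuns n r)) (allPerms n)

-- letter at 1-based position p : (value ω(p) ∈ {1..n}, color τ(p)),
-- with the convention ω(n+1) = n+1, τ(n+1) = 0.
-- (argument is the 0-based position p-1)
letter : ∀ {n r} → ColPerm n r → ℕ → ℕ × ℕ
letter {n} (ω , τ) k with k <? n
... | yes k<n = suc (toℕ (ω (fromℕ< k<n))) , toℕ (τ (fromℕ< k<n))
... | no  _   = suc n , 0

_>ₛ_ : ℕ × ℕ → ℕ × ℕ → Set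
(v , c) >ₛ (v′ , c′) = (c′ < c) ⊎ ((c ≡ c′) × (v′ < v))

_>ₛ?_ : ∀ x y → Dec (x >ₛ y)
(v , c) >ₛ? (v′ , c′) = (c′ <? c) ⊎-dec ((c ≟ c′) ×-dec (v′ <? v))

-- i ∈ [n] (1-based) is a descent of σ : σ(i) > σ(i+1)
IsDescent : ∀ {n r} → ColPerm n r → ℕ → Set
IsDescent σ i = letter σ (i ∸ 1) >ₛ letter σ i

descent? : ∀ {n r} (σ : ColPerm n r) i → Dec (IsDescent σ i)
descent? σ i = letter σ (i ∸ 1) >ₛ? letter σ i

X : ∀ {n r} → ℕ → ColPerm n r → ℕ
X i σ with descent? σ i
... | yes _ = 1
... | no  _ = 0

prodX : ∀ {n r} → ℕ → ℕ → ColPerm n r → ℕ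
prodX a b σ = product (map (λ j → X (a + j) σ) (upTo (suc b ∸ a)))

average : ∀ {A : Set} → List A → (A → ℕ) → ℚ
average xs f with length xs
... | zero  = 0ℚ
... | suc k = (+ sum (map f xs)) / suc k

𝔼 : ∀ n r → (ColPerm n r → ℕ) → ℚ
𝔼 n r f = average (allColPerms n r) f

{-# OPTIONS --safe #-}
-- X_{m+1} ⋯ X_n = 1 says that the last d = n − m symbols of (ω , τ) strictly decrease and stay above
-- the symbol (n+1)^0 that follows them, i.e. the last color is nonzero.  Read (ω , τ) as a word of
-- n letters (value , color) with distinct values.  The first m letters can be chosen in (n − i) r
-- ways each, the remaining values being relabelled after every choice, so it remains to count
-- descending words.  Those of length k with distinct values below N obey Pascal's rule
-- c(k , N + 1) = c(k , N) + (r − 1) c(k − 1 , N): if the value 0 occurs, deleting it leaves a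
-- descending word, and (0 , c) fits back into such a word at exactly one position when c ≠ 0 and at
-- none when c = 0.  Hence c(d , d) = (r − 1)^d, there are n! / d! · r^m (r − 1)^d favourable words
-- out of n! r^n, and the quotient is the stated formula.
module Submission where

open import Defs

module Counting where

  open import Data.Nat.Base using (ℕ; zero; suc; _+_; _*_; _∸_; _^_; _<_; _≤_; _!; NonZero; z≤n; s<s; s<s⁻¹)
  open import Data.Nat.Properties
    using ( +-*-semiring; +-identityʳ; *-identityˡ; *-identityʳ; *-zeroʳ; *-assoc; *-comm; *-distribˡ-+; *-distribʳ-+
          ; *-commutativeSemigroup
          ; suc-injective; <-cmp; <-trans; <-irrefl; <-asym; <⇒≤; <-≤-trans; ≤-reflexive; ≰⇒>; <⇒≱; m<n⇒m<1+n; n<1+n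
          ; m*n≢0; m^n≢0; _!≢0; ^-distribˡ-+-* )
    renaming (_<?_ to _<ℕ?_)
  open import Data.Nat.Tactic.RingSolver using (solve-∀)
  open import Data.Nat.ListAction using (sum; product)
  open import Data.Nat.ListAction.Properties using (sum-++)
  open import Data.Integer.Base as ℤ using (+_)
  open import Data.Integer.Properties using (pos-*)
  open import Data.Rational.Base using (_/_; toℚᵘ) renaming (_*_ to _*ℚ_)
  open import Data.Rational.Properties using (toℚᵘ-injective; toℚᵘ-fromℚᵘ; toℚᵘ-homo-*; fromℚᵘ-cong)
  open import Data.Rational.Unnormalised.Base using (mkℚᵘ; *≡*) renaming (_*_ to _*ᵘ_)
  open import Data.Rational.Unnormalised.Properties using (module ≃-Reasoning) renaming (*-cong to *ᵘ-cong)
  open import Data.Bool.Base using (Bool; true; false; _∧_; not; T)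
  open import Data.Bool.Properties using (∧-assoc; ∧-identityʳ; ∧-commutativeMonoid; T-∧)
  open import Data.Fin.Base as Fin using (Fin; toℕ; fromℕ<; punchIn)
  open import Data.Fin.Properties
    using (_≟_; 0≢1+n; toℕ<n; toℕ-injective; punchIn-injective; punchInᵢ≢i; punchIn-mono-≤; punchIn-cancel-≤)
    renaming (suc-injective to Fin-suc-injective)
  open import Data.List.Base using (List; []; _∷_; _++_; map; concatMap; filter; length; allFin; tabulate; applyUpTo; upTo)
  open import Data.List.Properties using (map-∘; map-cong; map-tabulate; map-++)
  open import Data.Product.Base as Product using (_×_; _,_; proj₁; proj₂; map₁)
  open import Data.Sum.Base as Sum using (_⊎_; inj₁; inj₂)
  open import Data.Vec.Base as Vec using (Vec; []; _∷_; lookup; insertAt)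
  open import Data.Vec.Properties using (insertAt-lookup)
  open import Data.Vec.Functional using () renaming (_∷_ to _∷ᶠ_)
  open import Algebra.Bundles using (CommutativeMonoid)
  open import Algebra.Properties.Semiring.Sum +-*-semiring
    using (sum-syntax; sum-cong-≗; sum-remove; sum-replicate-zero; ∑-distrib-+; ∑-comm; *-distribˡ-sum; *-distribʳ-sum)
  open import Algebra.Properties.CommutativeSemigroup (CommutativeMonoid.commutativeSemigroup ∧-commutativeMonoid)
    using () renaming (interchange to ∧-interchange; x∙yz≈y∙xz to ∧-leftComm)
  open import Algebra.Properties.CommutativeSemigroup *-commutativeSemigroup
    using () renaming (x∙yz≈y∙xz to *-leftComm)
  open import Function.Base using (_∘_)
  open import Function.Bundles using (_⇔_; mk⇔; module Equivalence)
  open import Relation.Binary.Definitions using (tri<; tri≈; tri>)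
  open import Relation.Binary.PropositionalEquality
  open import Relation.Nullary using (Dec; yes; no; does; ¬_; contradiction; T?)
  open import Relation.Nullary.Decidable using (dec-true; dec-false; does-⇔)
  open Equivalence using (to; from)

  𝟙 : Bool → ℕ
  𝟙 true  = 1
  𝟙 false = 0

  𝟙-∧ : ∀ a b → 𝟙 (a ∧ b) ≡ 𝟙 a * 𝟙 b
  𝟙-∧ true  b = sym (+-identityʳ (𝟙 b))
  𝟙-∧ false b = refl

  𝟙-T : ∀ {b} → T b → 𝟙 b ≡ 1
  𝟙-T {true} _ = refl

  𝟙-¬T : ∀ {b} → ¬ T b → 𝟙 b ≡ 0
  𝟙-¬T {true}  ¬t = contradiction _ ¬t
  𝟙-¬T {false} _  = refl

  T-does⁻ : ∀ {P : Set} (d : Dec P) → T (does d) → P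
  T-does⁻ (yes p) _ = p

  T-does⁺ : ∀ {P : Set} (d : Dec P) → P → T (does d)
  T-does⁺ (yes _) _ = _
  T-does⁺ (no ¬p) p = ¬p p

  T-not-does⁻ : ∀ {P : Set} (d : Dec P) → T (not (does d)) → ¬ P
  T-not-does⁻ (no ¬p) _ = ¬p

  T-not-does⁺ : ∀ {P : Set} (d : Dec P) → ¬ P → T (not (does d))
  T-not-does⁺ (yes p) ¬p = ¬p p
  T-not-does⁺ (no _)  _  = _

  ∑-const : ∀ n c → ∑[ i < n ] c ≡ n * c
  ∑-const zero    c = refl
  ∑-const (suc n) c = cong (_+_ c) (∑-const n c)

  ∑-positive : ∀ n → ∑[ c < n ] 𝟙 (does (0 <ℕ? toℕ c)) ≡ n ∸ 1
  ∑-positive zero    = refl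
  ∑-positive (suc n) = trans (∑-const n 1) (*-identityʳ n)

  ∑-punchIn : ∀ {n} (i : Fin (suc n)) (f : Fin (suc n) → ℕ) →
              ∑[ j < suc n ] (𝟙 (not (does (i ≟ j))) * f j) ≡ ∑[ j < n ] f (punchIn i j)
  ∑-punchIn {n} i f = begin
    ∑[ j < suc n ] (𝟙 (not (does (i ≟ j))) * f j)
      ≡⟨ sum-remove {i = i} (λ j → 𝟙 (not (does (i ≟ j))) * f j) ⟩
    𝟙 (not (does (i ≟ i))) * f i + ∑[ j < n ] (𝟙 (not (does (i ≟ punchIn i j))) * f (punchIn i j))
      ≡⟨ cong₂ _+_ (cong (λ b → 𝟙 (not b) * f i) (dec-true (i ≟ i) refl))
                   (sum-cong-≗ λ j → cong (λ b → 𝟙 (not b) * f (punchIn i j))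
                                          (dec-false (i ≟ punchIn i j) (punchInᵢ≢i i j ∘ sym))) ⟩
    ∑[ j < n ] (f (punchIn i j) + 0)
      ≡⟨ sum-cong-≗ (λ j → +-identityʳ (f (punchIn i j))) ⟩
    ∑[ j < n ] f (punchIn i j) ∎
    where open ≡-Reasoning

  ∑-delta : ∀ {n} (i : Fin n) (f : Fin n → ℕ) → ∑[ j < n ] (𝟙 (does (i ≟ j)) * f j) ≡ f i
  ∑-delta {suc n} i f = begin
    ∑[ j < suc n ] (𝟙 (does (i ≟ j)) * f j)
      ≡⟨ sum-remove {i = i} (λ j → 𝟙 (does (i ≟ j)) * f j) ⟩
    𝟙 (does (i ≟ i)) * f i + ∑[ j < n ] (𝟙 (does (i ≟ punchIn i j)) * f (punchIn i j))
      ≡⟨ cong₂ _+_ (cong (λ b → 𝟙 b * f i) (dec-true (i ≟ i) refl))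
                   (sum-cong-≗ λ j → cong (λ b → 𝟙 b * f (punchIn i j))
                                          (dec-false (i ≟ punchIn i j) (punchInᵢ≢i i j ∘ sym))) ⟩
    (f i + 0) + ∑[ j < n ] 0
      ≡⟨ cong₂ _+_ (+-identityʳ (f i)) (sum-replicate-zero n) ⟩
    f i + 0
      ≡⟨ +-identityʳ (f i) ⟩
    f i ∎
    where open ≡-Reasoning

  length≡sum-map-1 : ∀ {A : Set} (xs : List A) → length xs ≡ sum (map (λ _ → 1) xs)
  length≡sum-map-1 []       = refl
  length≡sum-map-1 (x ∷ xs) = cong suc (length≡sum-map-1 xs)

  map-applyUpTo : ∀ {A B : Set} (f : A → B) (g : ℕ → A) n → map f (applyUpTo g n) ≡ applyUpTo (f ∘ g) n
  map-applyUpTo f g zero    = refl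
  map-applyUpTo f g (suc n) = cong (f (g 0) ∷_) (map-applyUpTo f (g ∘ suc) n)

  sum-map-concatMap : ∀ {A B : Set} (f : B → ℕ) (g : A → List B) xs →
                      sum (map f (concatMap g xs)) ≡ sum (map (λ x → sum (map f (g x))) xs)
  sum-map-concatMap f g []       = refl
  sum-map-concatMap f g (x ∷ xs) = begin
    sum (map f (g x ++ concatMap g xs))
      ≡⟨ cong sum (map-++ f (g x) (concatMap g xs)) ⟩
    sum (map f (g x) ++ map f (concatMap g xs))
      ≡⟨ sum-++ (map f (g x)) _ ⟩
    sum (map f (g x)) + sum (map f (concatMap g xs))
      ≡⟨ cong (_+_ (sum (map f (g x)))) (sum-map-concatMap f g xs) ⟩
    sum (map f (g x)) + sum (map (λ x → sum (map f (g x))) xs) ∎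
    where open ≡-Reasoning

  sum-map-filter : ∀ {A : Set} {P : A → Set} (P? : ∀ x → Dec (P x)) (f : A → ℕ) xs →
                   sum (map f (filter P? xs)) ≡ sum (map (λ x → 𝟙 (does (P? x)) * f x) xs)
  sum-map-filter P? f []       = refl
  sum-map-filter P? f (x ∷ xs) with does (P? x)
  ... | true  = cong₂ _+_ (sym (+-identityʳ (f x))) (sum-map-filter P? f xs)
  ... | false = sum-map-filter P? f xs

  sum-tabulate : ∀ {n} (f : Fin n → ℕ) → sum (tabulate f) ≡ ∑[ i < n ] f i
  sum-tabulate {zero}  f = refl
  sum-tabulate {suc n} f = cong (_+_ (f Fin.zero)) (sum-tabulate (f ∘ Fin.suc))

  sum-map-allFin : ∀ {n} (f : Fin n → ℕ) → sum (map f (allFin n)) ≡ ∑[ i < n ] f i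
  sum-map-allFin f = trans (cong sum (map-tabulate (λ i → i) f)) (sum-tabulate f)

  *-distribˡ-sum-map : ∀ {A : Set} c (f : A → ℕ) xs → c * sum (map f xs) ≡ sum (map (λ x → c * f x) xs)
  *-distribˡ-sum-map c f []       = *-zeroʳ c
  *-distribˡ-sum-map c f (x ∷ xs) = trans (*-distribˡ-+ c (f x) _) (cong (_+_ (c * f x)) (*-distribˡ-sum-map c f xs))

  sum-map-∑ : ∀ {A : Set} {m} (f : A → Fin m → ℕ) xs →
              sum (map (λ x → ∑[ i < m ] f x i) xs) ≡ ∑[ i < m ] sum (map (λ x → f x i) xs)
  sum-map-∑ {m = m} f []       = sym (sum-replicate-zero m)
  sum-map-∑         f (x ∷ xs) = trans (cong (_+_ (∑[ i < _ ] f x i)) (sum-map-∑ f xs)) (sym (∑-distrib-+ (f x) _))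

  sum-allFuns-suc : ∀ n K (h : (Fin (suc n) → Fin K) → ℕ) →
                    sum (map h (allFuns (suc n) K)) ≡ ∑[ i < K ] sum (map (λ f → h (i ∷ᶠ f)) (allFuns n K))
  sum-allFuns-suc n K h = begin
    sum (map h (concatMap (λ i → map (i ∷ᶠ_) (allFuns n K)) (allFin K)))
      ≡⟨ sum-map-concatMap h (λ i → map (i ∷ᶠ_) (allFuns n K)) (allFin K) ⟩
    sum (map (λ i → sum (map h (map (i ∷ᶠ_) (allFuns n K)))) (allFin K))
      ≡⟨ sum-map-allFin (λ i → sum (map h (map (i ∷ᶠ_) (allFuns n K)))) ⟩
    ∑[ i < K ] sum (map h (map (i ∷ᶠ_) (allFuns n K)))
      ≡⟨ sum-cong-≗ (λ i → cong sum (sym (map-∘ {g = h} {f = i ∷ᶠ_} (allFuns n K)))) ⟩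
    ∑[ i < K ] sum (map (λ f → h (i ∷ᶠ f)) (allFuns n K)) ∎
    where open ≡-Reasoning

  ≟-sym : ∀ {n} (u v : Fin n) → does (u ≟ v) ≡ does (v ≟ u)
  ≟-sym u v = does-⇔ (mk⇔ sym sym) (u ≟ v) (v ≟ u)

  punchIn-≟ : ∀ {n} (i : Fin (suc n)) (u v : Fin n) → does (punchIn i u ≟ punchIn i v) ≡ does (u ≟ v)
  punchIn-≟ i u v = does-⇔ (mk⇔ (punchIn-injective i u v) (cong (punchIn i))) (punchIn i u ≟ punchIn i v) (u ≟ v)

  punchIn-<-⇔ : ∀ {n} (i : Fin (suc n)) (u v : Fin n) → toℕ (punchIn i u) < toℕ (punchIn i v) ⇔ toℕ u < toℕ v
  punchIn-<-⇔ i u v = mk⇔ (λ lt → ≰⇒> λ v≤u → <⇒≱ lt (punchIn-mono-≤ i v u v≤u))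
                           (λ lt → ≰⇒> λ pv≤pu → <⇒≱ lt (punchIn-cancel-≤ i v u pv≤pu))

  -- The order on symbols

  >ₛ-trans : ∀ {v₁ c₁ v₂ c₂ v₃ c₃} →
             (v₁ , c₁) >ₛ (v₂ , c₂) → (v₂ , c₂) >ₛ (v₃ , c₃) → (v₁ , c₁) >ₛ (v₃ , c₃)
  >ₛ-trans (inj₁ c₂<c₁)          (inj₁ c₃<c₂)          = inj₁ (<-trans c₃<c₂ c₂<c₁)
  >ₛ-trans (inj₁ c₂<c₁)          (inj₂ (refl , _))     = inj₁ c₂<c₁
  >ₛ-trans (inj₂ (refl , _))     (inj₁ c₃<c₂)          = inj₁ c₃<c₂
  >ₛ-trans (inj₂ (refl , v₂<v₁)) (inj₂ (refl , v₃<v₂)) = inj₂ (refl , <-trans v₃<v₂ v₂<v₁)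

  >ₛ-irrefl : ∀ {v c} → ¬ ((v , c) >ₛ (v , c))
  >ₛ-irrefl (inj₁ c<c)       = <-irrefl refl c<c
  >ₛ-irrefl (inj₂ (_ , v<v)) = <-irrefl refl v<v

  >ₛ-asym : ∀ {v₁ c₁ v₂ c₂} → (v₁ , c₁) >ₛ (v₂ , c₂) → ¬ ((v₂ , c₂) >ₛ (v₁ , c₁))
  >ₛ-asym x>y y>x = >ₛ-irrefl (>ₛ-trans x>y y>x)

  >ₛ⇒color-≥ : ∀ {v₁ c₁ v₂ c₂} → (v₁ , c₁) >ₛ (v₂ , c₂) → c₂ ≤ c₁
  >ₛ⇒color-≥ (inj₁ c₂<c₁)     = <⇒≤ c₂<c₁
  >ₛ⇒color-≥ (inj₂ (refl , _)) = ≤-reflexive refl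

  >ₛ-connex : ∀ {v₁ c₁ v₂ c₂} → v₁ ≢ v₂ → (v₁ , c₁) >ₛ (v₂ , c₂) ⊎ (v₂ , c₂) >ₛ (v₁ , c₁)
  >ₛ-connex {v₁} {c₁} {v₂} {c₂} v₁≢v₂ with <-cmp c₁ c₂ | <-cmp v₁ v₂
  ... | tri< c₁<c₂ _ _ | _                = inj₂ (inj₁ c₁<c₂)
  ... | tri> _ _ c₂<c₁ | _                = inj₁ (inj₁ c₂<c₁)
  ... | tri≈ _ refl _  | tri< v₁<v₂ _ _   = inj₂ (inj₂ (refl , v₁<v₂))
  ... | tri≈ _ refl _  | tri≈ _ v₁≡v₂ _   = contradiction v₁≡v₂ v₁≢v₂
  ... | tri≈ _ refl _  | tri> _ _ v₂<v₁   = inj₁ (inj₂ (refl , v₂<v₁))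

  >ₛ-value-⇔ : ∀ {v₁ v₂ u₁ u₂ c₁ c₂} → (v₂ < v₁ ⇔ u₂ < u₁) →
               (v₁ , c₁) >ₛ (v₂ , c₂) ⇔ (u₁ , c₁) >ₛ (u₂ , c₂)
  >ₛ-value-⇔ v⇔u = mk⇔ (Sum.map₂ (Product.map₂ (to v⇔u))) (Sum.map₂ (Product.map₂ (from v⇔u)))

  isPerm?-cong : ∀ {n} {ω ω′ : Fin n → Fin n} → ω ≗ ω′ → does (isPerm? ω) ≡ does (isPerm? ω′)
  isPerm?-cong {ω = ω} {ω′} ω≗ω′ = does-⇔ (mk⇔ ⇒ ⇐) (isPerm? ω) (isPerm? ω′)
    where
    ⇒ : IsPerm ω → IsPerm ω′
    ⇒ inj i j e = inj i j (trans (ω≗ω′ i) (trans e (sym (ω≗ω′ j))))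
    ⇐ : IsPerm ω′ → IsPerm ω
    ⇐ inj i j e = inj i j (trans (sym (ω≗ω′ i)) (trans e (ω≗ω′ j)))

  letter-cong : ∀ {n r} {ω ω′ : Fin n → Fin n} {τ τ′ : Fin n → Fin r} → ω ≗ ω′ → τ ≗ τ′ →
                ∀ q → letter (ω , τ) q ≡ letter (ω′ , τ′) q
  letter-cong {n} ω≗ω′ τ≗τ′ q with q <ℕ? n
  ... | yes q<n = cong₂ (λ v c → suc (toℕ v) , toℕ c) (ω≗ω′ (fromℕ< q<n)) (τ≗τ′ (fromℕ< q<n))
  ... | no  _   = refl

  X≡𝟙 : ∀ {n r} i (σ : ColPerm n r) → X i σ ≡ 𝟙 (does (descent? σ i))
  X≡𝟙 i σ with descent? σ i in eq
  ... | yes _ = cong (𝟙 ∘ does) (sym eq)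
  ... | no  _ = cong (𝟙 ∘ does) (sym eq)

  prodX-cong : ∀ {n r} a b {ω ω′ : Fin n → Fin n} {τ τ′ : Fin n → Fin r} → ω ≗ ω′ → τ ≗ τ′ →
               prodX a b (ω , τ) ≡ prodX a b (ω′ , τ′)
  prodX-cong a b {ω} {ω′} {τ} {τ′} ω≗ω′ τ≗τ′ = cong product (map-cong (λ j → begin
    X (a + j) (ω , τ)
      ≡⟨ X≡𝟙 (a + j) (ω , τ) ⟩
    𝟙 (does (letter (ω , τ) (a + j ∸ 1) >ₛ? letter (ω , τ) (a + j)))
      ≡⟨ cong₂ (λ x y → 𝟙 (does (x >ₛ? y))) (letter-cong ω≗ω′ τ≗τ′ (a + j ∸ 1)) (letter-cong ω≗ω′ τ≗τ′ (a + j)) ⟩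
    𝟙 (does (letter (ω′ , τ′) (a + j ∸ 1) >ₛ? letter (ω′ , τ′) (a + j)))
      ≡⟨ X≡𝟙 (a + j) (ω′ , τ′) ⟨
    X (a + j) (ω′ , τ′) ∎) (upTo (suc b ∸ a)))
    where open ≡-Reasoning

  -- Words of colored letters

  module _ (r : ℕ) where

    Letter : ℕ → Set
    Letter N = Fin N × Fin r

    Word : ℕ → ℕ → Set
    Word N k = Vec (Letter N) k

    -- As in Defs.letter, the value v is written v + 1.
    symbol : ∀ {N} → Letter N → ℕ × ℕ
    symbol (v , c) = suc (toℕ v) , toℕ c

    _≻?_ : ∀ {N} (a b : Letter N) → Dec (symbol a >ₛ symbol b)
    a ≻? b = symbol a >ₛ? symbol b

    ∑ˡ : ∀ {N} → (Letter N → ℕ) → ℕ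
    ∑ˡ {N} f = ∑[ v < N ] ∑[ c < r ] f (v , c)

    ∑ʷ : ∀ {N} k → (Word N k → ℕ) → ℕ
    ∑ʷ zero    f = f []
    ∑ʷ (suc k) f = ∑ˡ λ a → ∑ʷ k λ w → f (a ∷ w)

    ∑ˡ-cong : ∀ {N} {f g : Letter N → ℕ} → (∀ a → f a ≡ g a) → ∑ˡ f ≡ ∑ˡ g
    ∑ˡ-cong f≗g = sum-cong-≗ λ v → sum-cong-≗ λ c → f≗g (v , c)

    ∑ʷ-cong : ∀ {N} k {f g : Word N k → ℕ} → (∀ w → f w ≡ g w) → ∑ʷ k f ≡ ∑ʷ k g
    ∑ʷ-cong zero    f≗g = f≗g []
    ∑ʷ-cong (suc k) f≗g = ∑ˡ-cong λ a → ∑ʷ-cong k λ w → f≗g (a ∷ w)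

    ∑ˡ-const : ∀ {N} c → ∑ˡ {N} (λ _ → c) ≡ N * (r * c)
    ∑ˡ-const {N} c = trans (sum-cong-≗ {N} λ _ → ∑-const r c) (∑-const N (r * c))

    ∑ˡ-distrib-+ : ∀ {N} (f g : Letter N → ℕ) → ∑ˡ (λ a → f a + g a) ≡ ∑ˡ f + ∑ˡ g
    ∑ˡ-distrib-+ f g = trans (sum-cong-≗ λ v → ∑-distrib-+ (λ c → f (v , c)) (λ c → g (v , c)))
                             (∑-distrib-+ (λ v → ∑[ c < r ] f (v , c)) (λ v → ∑[ c < r ] g (v , c)))

    ∑ʷ-distrib-+ : ∀ {N} k (f g : Word N k → ℕ) → ∑ʷ k (λ w → f w + g w) ≡ ∑ʷ k f + ∑ʷ k g
    ∑ʷ-distrib-+ zero    f g = refl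
    ∑ʷ-distrib-+ (suc k) f g =
      trans (∑ˡ-cong λ a → ∑ʷ-distrib-+ k (λ w → f (a ∷ w)) (λ w → g (a ∷ w)))
            (∑ˡ-distrib-+ (λ a → ∑ʷ k λ w → f (a ∷ w)) (λ a → ∑ʷ k λ w → g (a ∷ w)))

    *-distribˡ-∑ˡ : ∀ {N} x (f : Letter N → ℕ) → x * ∑ˡ f ≡ ∑ˡ (λ a → x * f a)
    *-distribˡ-∑ˡ x f =
      trans (*-distribˡ-sum x (λ v → ∑[ c < r ] f (v , c))) (sum-cong-≗ λ v → *-distribˡ-sum x (λ c → f (v , c)))

    *-distribˡ-∑ʷ : ∀ {N} k x (f : Word N k → ℕ) → x * ∑ʷ k f ≡ ∑ʷ k (λ w → x * f w)
    *-distribˡ-∑ʷ zero    x f = refl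
    *-distribˡ-∑ʷ (suc k) x f =
      trans (*-distribˡ-∑ˡ x λ a → ∑ʷ k λ w → f (a ∷ w)) (∑ˡ-cong λ a → *-distribˡ-∑ʷ k x λ w → f (a ∷ w))

    ∑ˡ-comm-∑ : ∀ {N m} (f : Letter N → Fin m → ℕ) →
                ∑ˡ (λ a → ∑[ i < m ] f a i) ≡ ∑[ i < m ] ∑ˡ (λ a → f a i)
    ∑ˡ-comm-∑ f = trans (sum-cong-≗ λ v → ∑-comm λ c i → f (v , c) i) (∑-comm λ v i → ∑[ c < r ] f (v , c) i)

    ∑ˡ-comm : ∀ {N M} (f : Letter N → Letter M → ℕ) → ∑ˡ (λ a → ∑ˡ (f a)) ≡ ∑ˡ (λ b → ∑ˡ (λ a → f a b))
    ∑ˡ-comm f =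
      trans (∑ˡ-comm-∑ λ a v → ∑[ c < r ] f a (v , c)) (sum-cong-≗ λ v → ∑ˡ-comm-∑ λ a c → f a (v , c))

    ∑ʷ-comm-∑ : ∀ {N m} k (f : Word N k → Fin m → ℕ) →
                ∑ʷ k (λ w → ∑[ i < m ] f w i) ≡ ∑[ i < m ] ∑ʷ k (λ w → f w i)
    ∑ʷ-comm-∑ zero    f = refl
    ∑ʷ-comm-∑ (suc k) f =
      trans (∑ˡ-cong λ a → ∑ʷ-comm-∑ k λ w → f (a ∷ w)) (∑ˡ-comm-∑ λ a i → ∑ʷ k λ w → f (a ∷ w) i)

    ∑ʷ-insertAt : ∀ {N} k (p : Fin (suc k)) (f : Word N (suc k) → ℕ) →
                  ∑ʷ (suc k) f ≡ ∑ˡ (λ a → ∑ʷ k (λ w → f (insertAt w p a)))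
    ∑ʷ-insertAt k       Fin.zero    f = refl
    ∑ʷ-insertAt (suc k) (Fin.suc p) f =
      trans (∑ˡ-cong λ b → ∑ʷ-insertAt k p λ w → f (b ∷ w))
            (∑ˡ-comm λ b a → ∑ʷ k λ w → f (b ∷ insertAt w p a))

    ∑ˡ-delta : ∀ {N} (v : Fin N) (f : Letter N → ℕ) →
               ∑ˡ (λ a → 𝟙 (does (v ≟ proj₁ a)) * f a) ≡ ∑[ c < r ] f (v , c)
    ∑ˡ-delta v f = trans (sum-cong-≗ λ u → sym (*-distribˡ-sum (𝟙 (does (v ≟ u))) λ c → f (u , c)))
                         (∑-delta v λ u → ∑[ c < r ] f (u , c))

    ∑ˡ-punchIn : ∀ {N} (i : Fin (suc N)) (f : Letter (suc N) → ℕ) →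
                 ∑ˡ (λ a → 𝟙 (not (does (i ≟ proj₁ a))) * f a) ≡ ∑ˡ (f ∘ map₁ (punchIn i))
    ∑ˡ-punchIn i f = trans (sum-cong-≗ λ u → sym (*-distribˡ-sum (𝟙 (not (does (i ≟ u)))) λ c → f (u , c)))
                           (∑-punchIn i λ u → ∑[ c < r ] f (u , c))

    -- For N = n the condition on the last letter is the comparison with the symbol (n+1)^0 that
    -- Defs.letter places after the word (see >ₛ-sentinel).
    descending : ∀ {N k} → Word N k → Bool
    descending []             = true
    descending ((_ , c) ∷ []) = does (0 <ℕ? toℕ c)
    descending (a ∷ b ∷ w)    = does (a ≻? b) ∧ descending (b ∷ w)

    descendingFrom : ∀ {N k} → ℕ → Word N k → Bool
    descendingFrom zero    w       = descending w
    descendingFrom (suc j) []      = true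
    descendingFrom (suc j) (_ ∷ w) = descendingFrom j w

    fresh : ∀ {N k} → Fin N → Word N k → Bool
    fresh v []            = true
    fresh v ((u , _) ∷ w) = not (does (v ≟ u)) ∧ fresh v w

    distinct : ∀ {N k} → Word N k → Bool
    distinct []            = true
    distinct ((v , _) ∷ w) = fresh v w ∧ distinct w

    relabel : ∀ {N k} → Fin (suc N) → Word N k → Word (suc N) k
    relabel i = Vec.map (map₁ (punchIn i))

    occurrences : ∀ {N k} → Fin N → Word N k → ℕ
    occurrences {k = k} v w = ∑[ p < k ] 𝟙 (does (v ≟ proj₁ (lookup w p)))

    ≻-relabel : ∀ {N} (i : Fin (suc N)) (a b : Letter N) →
                does (map₁ (punchIn i) a ≻? map₁ (punchIn i) b) ≡ does (a ≻? b)
    ≻-relabel i a b = does-⇔ (>ₛ-value-⇔ (mk⇔ (s<s ∘ to ⇔ ∘ s<s⁻¹) (s<s ∘ from ⇔ ∘ s<s⁻¹)))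
                                  (map₁ (punchIn i) a ≻? map₁ (punchIn i) b) (a ≻? b)
      where ⇔ = punchIn-<-⇔ i (proj₁ b) (proj₁ a)

    fresh-relabel : ∀ {N k} (i : Fin (suc N)) v (w : Word N k) → fresh (punchIn i v) (relabel i w) ≡ fresh v w
    fresh-relabel i v []            = refl
    fresh-relabel i v ((u , _) ∷ w) = cong₂ (λ b c → not b ∧ c) (punchIn-≟ i v u) (fresh-relabel i v w)

    distinct-relabel : ∀ {N k} (i : Fin (suc N)) (w : Word N k) → distinct (relabel i w) ≡ distinct w
    distinct-relabel i []            = refl
    distinct-relabel i ((v , _) ∷ w) = cong₂ _∧_ (fresh-relabel i v w) (distinct-relabel i w)

    descending-relabel : ∀ {N k} (i : Fin (suc N)) (w : Word N k) → descending (relabel i w) ≡ descending w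
    descending-relabel i []          = refl
    descending-relabel i (a ∷ [])    = refl
    descending-relabel i (a ∷ b ∷ w) = cong₂ _∧_ (≻-relabel i a b) (descending-relabel i (b ∷ w))

    descendingFrom-relabel : ∀ {N k} j (i : Fin (suc N)) (w : Word N k) →
                             descendingFrom j (relabel i w) ≡ descendingFrom j w
    descendingFrom-relabel zero    i w       = descending-relabel i w
    descendingFrom-relabel (suc j) i []      = refl
    descendingFrom-relabel (suc j) i (_ ∷ w) = descendingFrom-relabel j i w

    fresh-relabel-self : ∀ {N k} (i : Fin (suc N)) (w : Word N k) → T (fresh i (relabel i w))
    fresh-relabel-self i []            = _
    fresh-relabel-self i ((u , _) ∷ w) =
      from T-∧ (T-not-does⁺ (i ≟ punchIn i u) (punchInᵢ≢i i u ∘ sym) , fresh-relabel-self i w)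

    ∑ʷ-fresh : ∀ {N} k (i : Fin (suc N)) (f : Word (suc N) k → ℕ) →
               ∑ʷ k (λ w → 𝟙 (fresh i w) * f w) ≡ ∑ʷ k (f ∘ relabel i)
    ∑ʷ-fresh zero    i f = *-identityˡ (f [])
    ∑ʷ-fresh {N} (suc k) i f = begin
      ∑ˡ (λ a → ∑ʷ k λ w → 𝟙 (avoids a ∧ fresh i w) * f (a ∷ w))
        ≡⟨ ∑ˡ-cong (λ a → ∑ʷ-cong k λ w → trans (cong (_* f (a ∷ w)) (𝟙-∧ (avoids a) (fresh i w)))
                                               (*-assoc (𝟙 (avoids a)) (𝟙 (fresh i w)) (f (a ∷ w)))) ⟩
      ∑ˡ (λ a → ∑ʷ k λ w → 𝟙 (avoids a) * (𝟙 (fresh i w) * f (a ∷ w)))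
        ≡⟨ ∑ˡ-cong (λ a → sym (*-distribˡ-∑ʷ k (𝟙 (avoids a)) λ w → 𝟙 (fresh i w) * f (a ∷ w))) ⟩
      ∑ˡ (λ a → 𝟙 (avoids a) * ∑ʷ k λ w → 𝟙 (fresh i w) * f (a ∷ w))
        ≡⟨ ∑ˡ-punchIn i (λ a → ∑ʷ k λ w → 𝟙 (fresh i w) * f (a ∷ w)) ⟩
      ∑ˡ (λ a → ∑ʷ k λ w → 𝟙 (fresh i w) * f (map₁ (punchIn i) a ∷ w))
        ≡⟨ ∑ˡ-cong (λ a → ∑ʷ-fresh k i λ w → f (map₁ (punchIn i) a ∷ w)) ⟩
      ∑ʷ (suc k) (f ∘ relabel i) ∎
      where
      open ≡-Reasoning
      avoids : Letter (suc N) → Bool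
      avoids a = not (does (i ≟ proj₁ a))

    occurrences-fresh : ∀ {N k} (v : Fin N) (w : Word N k) → T (fresh v w) → occurrences v w ≡ 0
    occurrences-fresh v []            _        = refl
    occurrences-fresh v ((u , _) ∷ w) fresh-vw with v ≟ u
    ... | no _ = occurrences-fresh v w fresh-vw

    occurrences-distinct : ∀ {N k} (v : Fin N) (w : Word N k) → T (distinct w) → 𝟙 (fresh v w) + occurrences v w ≡ 1
    occurrences-distinct v []            _          = refl
    occurrences-distinct v ((u , _) ∷ w) distinct-w with v ≟ u
    ... | yes refl = cong suc (occurrences-fresh v w (proj₁ (to T-∧ distinct-w)))
    ... | no  _    = occurrences-distinct v w (proj₂ (to T-∧ distinct-w))

    𝟙-split-occurrences : ∀ {N k} (v : Fin N) (w : Word N k) b →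
                          𝟙 (distinct w ∧ b)
                            ≡ 𝟙 (fresh v w) * 𝟙 (distinct w ∧ b) + occurrences v w * 𝟙 (distinct w ∧ b)
    𝟙-split-occurrences v w b with distinct w in eq
    ... | false = sym (cong₂ _+_ (*-zeroʳ (𝟙 (fresh v w))) (*-zeroʳ (occurrences v w)))
    ... | true  = sym (begin
      𝟙 (fresh v w) * 𝟙 b + occurrences v w * 𝟙 b ≡⟨ *-distribʳ-+ (𝟙 b) (𝟙 (fresh v w)) _ ⟨
      (𝟙 (fresh v w) + occurrences v w) * 𝟙 b      ≡⟨ cong (_* 𝟙 b) (occurrences-distinct v w (subst T (sym eq) _)) ⟩
      1 * 𝟙 b                                      ≡⟨ *-identityˡ (𝟙 b) ⟩
      𝟙 b                                          ∎)
      where open ≡-Reasoning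

    ∑ʷ-occurrences : ∀ {N} k (v : Fin N) (f : Word N (suc k) → ℕ) →
                     ∑ʷ (suc k) (λ w → occurrences v w * f w)
                       ≡ ∑[ p < suc k ] ∑[ c < r ] ∑ʷ k (λ w → f (insertAt w p (v , c)))
    ∑ʷ-occurrences k v f = begin
      ∑ʷ (suc k) (λ w → occurrences v w * f w)
        ≡⟨ ∑ʷ-cong (suc k) (λ w → *-distribʳ-sum (f w) λ p → 𝟙 (does (v ≟ proj₁ (lookup w p)))) ⟩
      ∑ʷ (suc k) (λ w → ∑[ p < suc k ] (𝟙 (does (v ≟ proj₁ (lookup w p))) * f w))
        ≡⟨ ∑ʷ-comm-∑ (suc k) (λ w p → 𝟙 (does (v ≟ proj₁ (lookup w p))) * f w) ⟩
      ∑[ p < suc k ] ∑ʷ (suc k) (λ w → 𝟙 (does (v ≟ proj₁ (lookup w p))) * f w)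
        ≡⟨ sum-cong-≗ (λ p → ∑ʷ-insertAt k p λ w → 𝟙 (does (v ≟ proj₁ (lookup w p))) * f w) ⟩
      ∑[ p < suc k ] ∑ˡ (λ a → ∑ʷ k λ w → 𝟙 (does (v ≟ proj₁ (lookup (insertAt w p a) p))) * f (insertAt w p a))
        ≡⟨ sum-cong-≗ (λ p → ∑ˡ-cong λ a → trans
             (∑ʷ-cong k λ w → cong (λ b → 𝟙 (does (v ≟ proj₁ b)) * f (insertAt w p a)) (insertAt-lookup w p a))
             (sym (*-distribˡ-∑ʷ k (𝟙 (does (v ≟ proj₁ a))) λ w → f (insertAt w p a)))) ⟩
      ∑[ p < suc k ] ∑ˡ (λ a → 𝟙 (does (v ≟ proj₁ a)) * ∑ʷ k λ w → f (insertAt w p a))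
        ≡⟨ sum-cong-≗ (λ p → ∑ˡ-delta v λ a → ∑ʷ k λ w → f (insertAt w p a)) ⟩
      ∑[ p < suc k ] ∑[ c < r ] ∑ʷ k (λ w → f (insertAt w p (v , c))) ∎
      where open ≡-Reasoning

    -- Inserting a letter into a descending word

    fresh-insertAt : ∀ {N k} v (w : Word N k) p (a : Letter N) →
                     fresh v (insertAt w p a) ≡ not (does (v ≟ proj₁ a)) ∧ fresh v w
    fresh-insertAt v w       Fin.zero    a = refl
    fresh-insertAt v (b ∷ w) (Fin.suc p) a =
      trans (cong (not (does (v ≟ proj₁ b)) ∧_) (fresh-insertAt v w p a))
            (∧-leftComm (not (does (v ≟ proj₁ b))) (not (does (v ≟ proj₁ a))) (fresh v w))

    distinct-insertAt : ∀ {N k} (w : Word N k) p (a : Letter N) → distinct (insertAt w p a) ≡ fresh (proj₁ a) w ∧ distinct w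
    distinct-insertAt w       Fin.zero    a = refl
    distinct-insertAt (b ∷ w) (Fin.suc p) a = begin
      fresh (proj₁ b) (insertAt w p a) ∧ distinct (insertAt w p a)
        ≡⟨ cong₂ _∧_ (fresh-insertAt (proj₁ b) w p a) (distinct-insertAt w p a) ⟩
      (not (does (proj₁ b ≟ proj₁ a)) ∧ fresh (proj₁ b) w) ∧ (fresh (proj₁ a) w ∧ distinct w)
        ≡⟨ ∧-interchange (not (does (proj₁ b ≟ proj₁ a))) (fresh (proj₁ b) w) (fresh (proj₁ a) w) (distinct w) ⟩
      (not (does (proj₁ b ≟ proj₁ a)) ∧ fresh (proj₁ a) w) ∧ (fresh (proj₁ b) w ∧ distinct w)
        ≡⟨ cong (λ t → (not t ∧ fresh (proj₁ a) w) ∧ (fresh (proj₁ b) w ∧ distinct w))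
                (≟-sym (proj₁ b) (proj₁ a)) ⟩
      (not (does (proj₁ a ≟ proj₁ b)) ∧ fresh (proj₁ a) w) ∧ (fresh (proj₁ b) w ∧ distinct w) ∎
      where open ≡-Reasoning

    𝟙-distinct-insertAt : ∀ {N k} (w : Word N k) p (a : Letter N) b →
                          𝟙 (distinct (insertAt w p a) ∧ b) ≡ 𝟙 (fresh (proj₁ a) w) * 𝟙 (distinct w ∧ b)
    𝟙-distinct-insertAt w p a b = begin
      𝟙 (distinct (insertAt w p a) ∧ b)      ≡⟨ cong (λ d → 𝟙 (d ∧ b)) (distinct-insertAt w p a) ⟩
      𝟙 ((fresh (proj₁ a) w ∧ distinct w) ∧ b) ≡⟨ cong 𝟙 (∧-assoc (fresh (proj₁ a) w) (distinct w) b) ⟩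
      𝟙 (fresh (proj₁ a) w ∧ (distinct w ∧ b)) ≡⟨ 𝟙-∧ (fresh (proj₁ a) w) (distinct w ∧ b) ⟩
      𝟙 (fresh (proj₁ a) w) * 𝟙 (distinct w ∧ b) ∎
      where open ≡-Reasoning

    ≻-connex : ∀ {N} (a b : Letter N) → proj₁ a ≢ proj₁ b → symbol a >ₛ symbol b ⊎ symbol b >ₛ symbol a
    ≻-connex a b a≢b = >ₛ-connex (a≢b ∘ toℕ-injective ∘ suc-injective)

    descending-tail : ∀ {N k} (a : Letter N) (w : Word N k) → T (descending (a ∷ w)) → T (descending w)
    descending-tail a []      _ = _
    descending-tail a (b ∷ w) d = proj₂ (to T-∧ d)

    descending⇒positive : ∀ {N k} (a : Letter N) (w : Word N k) → T (descending (a ∷ w)) → 0 < toℕ (proj₂ a)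
    descending⇒positive a []      d = T-does⁻ (0 <ℕ? toℕ (proj₂ a)) d
    descending⇒positive a (b ∷ w) d with to T-∧ d
    ... | a≻b , d′ = <-≤-trans (descending⇒positive b w d′) (>ₛ⇒color-≥ (T-does⁻ (a ≻? b) a≻b))

    ≻-inserted : ∀ {N k} (b x : Letter N) (u : Word N k) p →
                 T (descending (b ∷ insertAt u p x)) → symbol b >ₛ symbol x
    ≻-inserted b x u       Fin.zero    d = T-does⁻ (b ≻? x) (proj₁ (to T-∧ d))
    ≻-inserted b x (c ∷ u) (Fin.suc p) d with to T-∧ d
    ... | b≻c , d′ = >ₛ-trans (T-does⁻ (b ≻? c) b≻c) (≻-inserted c x u p d′)

    descending-insertAt⁻ : ∀ {N k} (u : Word N k) p x → T (descending (insertAt u p x)) → T (descending u)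
    descending-insertAt⁻ u           Fin.zero              x d = descending-tail x u d
    descending-insertAt⁻ (b ∷ [])    (Fin.suc Fin.zero)    x d =
      T-does⁺ (0 <ℕ? _) (descending⇒positive b (x ∷ []) d)
    descending-insertAt⁻ (b ∷ c ∷ u) (Fin.suc Fin.zero)    x d with to T-∧ d
    ... | b≻x , d′ with to T-∧ d′
    ... | x≻c , d″ =
      from T-∧ (T-does⁺ (b ≻? c) (>ₛ-trans (T-does⁻ (b ≻? x) b≻x) (T-does⁻ (x ≻? c) x≻c)) , d″)
    descending-insertAt⁻ (b ∷ c ∷ u) (Fin.suc (Fin.suc p)) x d =
      from T-∧ (proj₁ (to T-∧ d) , descending-insertAt⁻ (c ∷ u) (Fin.suc p) x (proj₂ (to T-∧ d)))

    descending-∷-insertAt : ∀ {N k} (b x : Letter N) (u : Word N k) p →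
                            symbol b >ₛ symbol x → T (descending (b ∷ u)) →
                            descending (b ∷ insertAt u p x) ≡ descending (insertAt u p x)
    descending-∷-insertAt b x u       Fin.zero    b≻x _ = cong (_∧ descending (x ∷ u)) (dec-true (b ≻? x) b≻x)
    descending-∷-insertAt b x (c ∷ u) (Fin.suc p) _   d =
      cong (_∧ descending (c ∷ insertAt u p x)) (dec-true (b ≻? c) (T-does⁻ (b ≻? c) (proj₁ (to T-∧ d))))

    -- As its value is fresh, x is comparable with every letter of u, and only the position in front of
    -- the first letter below x can work.
    ∑-descending-insertAt-descending :
      ∀ {N k} (x : Letter N) (u : Word N k) → T (fresh (proj₁ x) u) → T (descending u) →
      ∑[ p < suc k ] 𝟙 (descending (insertAt u p x)) ≡ 𝟙 (does (0 <ℕ? toℕ (proj₂ x)))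
    ∑-descending-insertAt-descending x [] _ _ = +-identityʳ _
    ∑-descending-insertAt-descending {k = suc k} x (b ∷ u) fresh-x d
      with ≻-connex x b (T-not-does⁻ (proj₁ x ≟ proj₁ b) (proj₁ (to T-∧ fresh-x)))
    ... | inj₁ x≻b = begin
      𝟙 (does (x ≻? b) ∧ descending (b ∷ u)) + ∑[ p < suc k ] 𝟙 (descending (b ∷ insertAt u p x))
        ≡⟨ cong₂ _+_ (𝟙-T (from T-∧ (T-does⁺ (x ≻? b) x≻b , d)))
                     (trans (sum-cong-≗ λ p → 𝟙-¬T (>ₛ-asym x≻b ∘ ≻-inserted b x u p))
                            (sum-replicate-zero (suc k))) ⟩
      1
        ≡⟨ sym (𝟙-T (T-does⁺ (0 <ℕ? _) (<-≤-trans (descending⇒positive b u d) (>ₛ⇒color-≥ x≻b)))) ⟩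
      𝟙 (does (0 <ℕ? toℕ (proj₂ x))) ∎
      where open ≡-Reasoning
    ... | inj₂ b≻x = begin
      𝟙 (does (x ≻? b) ∧ descending (b ∷ u)) + ∑[ p < suc k ] 𝟙 (descending (b ∷ insertAt u p x))
        ≡⟨ cong₂ _+_ (cong (λ t → 𝟙 (t ∧ descending (b ∷ u))) (dec-false (x ≻? b) (>ₛ-asym b≻x)))
                     (sum-cong-≗ λ p → cong 𝟙 (descending-∷-insertAt b x u p b≻x d)) ⟩
      ∑[ p < suc k ] 𝟙 (descending (insertAt u p x))
        ≡⟨ ∑-descending-insertAt-descending x u (proj₂ (to T-∧ fresh-x)) (descending-tail b u d) ⟩
      𝟙 (does (0 <ℕ? toℕ (proj₂ x))) ∎
      where open ≡-Reasoning

    ∑-descending-insertAt : ∀ {N k} (x : Letter N) (u : Word N k) → T (fresh (proj₁ x) u) →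
                            ∑[ p < suc k ] 𝟙 (descending (insertAt u p x))
                              ≡ 𝟙 (does (0 <ℕ? toℕ (proj₂ x))) * 𝟙 (descending u)
    ∑-descending-insertAt {k = k} x u fresh-x with descending u in eq
    ... | true  = trans (∑-descending-insertAt-descending x u fresh-x (subst T (sym eq) _))
                        (sym (*-identityʳ (𝟙 (does (0 <ℕ? toℕ (proj₂ x))))))
    ... | false = trans (sum-cong-≗ λ p → 𝟙-¬T λ d → subst T eq (descending-insertAt⁻ u p x d))
                        (trans (sum-replicate-zero (suc k)) (sym (*-zeroʳ (𝟙 (does (0 <ℕ? toℕ (proj₂ x)))))))

    ∑-insertAt-relabel : ∀ {N k} (i : Fin (suc N)) (w : Word N k) (c : Fin r) →
      ∑[ p < suc k ] 𝟙 (distinct (relabel i w) ∧ descending (insertAt (relabel i w) p (i , c)))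
        ≡ 𝟙 (does (0 <ℕ? toℕ c)) * 𝟙 (distinct w ∧ descending w)
    ∑-insertAt-relabel {k = k} i w c = begin
      ∑[ p < suc k ] 𝟙 (distinct w′ ∧ descending (insertAt w′ p (i , c)))
        ≡⟨ sum-cong-≗ (λ p → 𝟙-∧ (distinct w′) (descending (insertAt w′ p (i , c)))) ⟩
      ∑[ p < suc k ] (𝟙 (distinct w′) * 𝟙 (descending (insertAt w′ p (i , c))))
        ≡⟨ *-distribˡ-sum (𝟙 (distinct w′)) (λ p → 𝟙 (descending (insertAt w′ p (i , c)))) ⟨
      𝟙 (distinct w′) * ∑[ p < suc k ] 𝟙 (descending (insertAt w′ p (i , c)))
        ≡⟨ cong₂ (λ d s → 𝟙 d * s) (distinct-relabel i w)
                 (∑-descending-insertAt (i , c) w′ (fresh-relabel-self i w)) ⟩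
      𝟙 (distinct w) * (𝟙 positive * 𝟙 (descending w′))
        ≡⟨ cong (λ d → 𝟙 (distinct w) * (𝟙 positive * 𝟙 d)) (descending-relabel i w) ⟩
      𝟙 (distinct w) * (𝟙 positive * 𝟙 (descending w))
        ≡⟨ *-leftComm (𝟙 (distinct w)) (𝟙 positive) (𝟙 (descending w)) ⟩
      𝟙 positive * (𝟙 (distinct w) * 𝟙 (descending w))
        ≡⟨ cong (𝟙 positive *_) (𝟙-∧ (distinct w) (descending w)) ⟨
      𝟙 positive * 𝟙 (distinct w ∧ descending w) ∎
      where
      open ≡-Reasoning
      w′ = relabel i w
      positive = does (0 <ℕ? toℕ c)

    -- Counting descending words

    descendingCount : ℕ → ℕ → ℕ → ℕ
    descendingCount j k N = ∑ʷ {N} k (λ w → 𝟙 (distinct w ∧ descendingFrom j w))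

    ∑ʷ-fresh-descendingCount : ∀ {N} j k (i : Fin (suc N)) →
                               ∑ʷ k (λ w → 𝟙 (fresh i w) * 𝟙 (distinct w ∧ descendingFrom j w)) ≡ descendingCount j k N
    ∑ʷ-fresh-descendingCount j k i =
      trans (∑ʷ-fresh k i λ w → 𝟙 (distinct w ∧ descendingFrom j w))
            (∑ʷ-cong k λ w → cong₂ (λ a b → 𝟙 (a ∧ b)) (distinct-relabel i w) (descendingFrom-relabel j i w))

    descendingCount-suc : ∀ j k N → descendingCount (suc j) (suc k) (suc N) ≡ suc N * (r * descendingCount j k N)
    descendingCount-suc j k N = begin
      ∑ˡ (λ a → ∑ʷ k λ w → 𝟙 ((fresh (proj₁ a) w ∧ distinct w) ∧ descendingFrom j w))
        ≡⟨ ∑ˡ-cong (λ a → ∑ʷ-cong k λ w →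
             trans (cong 𝟙 (∧-assoc (fresh (proj₁ a) w) (distinct w) (descendingFrom j w)))
                   (𝟙-∧ (fresh (proj₁ a) w) (distinct w ∧ descendingFrom j w))) ⟩
      ∑ˡ (λ a → ∑ʷ k λ w → 𝟙 (fresh (proj₁ a) w) * 𝟙 (distinct w ∧ descendingFrom j w))
        ≡⟨ ∑ˡ-cong (λ a → ∑ʷ-fresh-descendingCount j k (proj₁ a)) ⟩
      ∑ˡ {suc N} (λ _ → descendingCount j k N)
        ≡⟨ ∑ˡ-const {suc N} (descendingCount j k N) ⟩
      suc N * (r * descendingCount j k N) ∎
      where open ≡-Reasoning

    ∑ʷ-occurrences-descending : ∀ {N} k (i : Fin (suc N)) →
      ∑ʷ (suc k) (λ w → occurrences i w * 𝟙 (distinct w ∧ descending w)) ≡ (r ∸ 1) * descendingCount 0 k N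
    ∑ʷ-occurrences-descending {N} k i = begin
      ∑ʷ (suc k) (λ w → occurrences i w * H w)
        ≡⟨ ∑ʷ-occurrences k i H ⟩
      ∑[ p < suc k ] ∑[ c < r ] ∑ʷ k (λ w → H (insertAt w p (i , c)))
        ≡⟨ ∑-comm (λ p c → ∑ʷ k λ w → H (insertAt w p (i , c))) ⟩
      ∑[ c < r ] ∑[ p < suc k ] ∑ʷ k (λ w → H (insertAt w p (i , c)))
        ≡⟨ sum-cong-≗ (λ c → ∑ʷ-comm-∑ k (λ w p → H (insertAt w p (i , c)))) ⟨
      ∑[ c < r ] ∑ʷ k (λ w → ∑[ p < suc k ] H (insertAt w p (i , c)))
        ≡⟨ sum-cong-≗ (λ c → ∑ʷ-cong k λ w → trans
             (sum-cong-≗ λ p → 𝟙-distinct-insertAt w p (i , c) (descending (insertAt w p (i , c))))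
             (sym (*-distribˡ-sum (𝟙 (fresh i w)) λ p → 𝟙 (distinct w ∧ descending (insertAt w p (i , c)))))) ⟩
      ∑[ c < r ] ∑ʷ k (λ w → 𝟙 (fresh i w) * ∑[ p < suc k ] 𝟙 (distinct w ∧ descending (insertAt w p (i , c))))
        ≡⟨ sum-cong-≗ (λ c → ∑ʷ-fresh k i λ w →
                               ∑[ p < suc k ] 𝟙 (distinct w ∧ descending (insertAt w p (i , c)))) ⟩
      ∑[ c < r ] ∑ʷ k (λ w → ∑[ p < suc k ] 𝟙 (distinct (relabel i w) ∧ descending (insertAt (relabel i w) p (i , c))))
        ≡⟨ sum-cong-≗ (λ c → ∑ʷ-cong k λ w → ∑-insertAt-relabel i w c) ⟩
      ∑[ c < r ] ∑ʷ {N} k (λ w → 𝟙 (does (0 <ℕ? toℕ c)) * 𝟙 (distinct w ∧ descending w))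
        ≡⟨ sum-cong-≗ {r} (λ c → *-distribˡ-∑ʷ {N} k (𝟙 (does (0 <ℕ? toℕ c))) H) ⟨
      ∑[ c < r ] (𝟙 (does (0 <ℕ? toℕ c)) * descendingCount 0 k N)
        ≡⟨ *-distribʳ-sum {r} (descendingCount 0 k N) (λ c → 𝟙 (does (0 <ℕ? toℕ c))) ⟨
      ∑[ c < r ] 𝟙 (does (0 <ℕ? toℕ c)) * descendingCount 0 k N
        ≡⟨ cong (_* descendingCount 0 k N) (∑-positive r) ⟩
      (r ∸ 1) * descendingCount 0 k N ∎
      where
      open ≡-Reasoning
      H : ∀ {M l} → Word M l → ℕ
      H w = 𝟙 (distinct w ∧ descending w)

    descendingCount-pascal : ∀ k N →
      descendingCount 0 (suc k) (suc N) ≡ descendingCount 0 (suc k) N + (r ∸ 1) * descendingCount 0 k N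
    descendingCount-pascal k N = begin
      ∑ʷ (suc k) H
        ≡⟨ ∑ʷ-cong (suc k) (λ w → 𝟙-split-occurrences Fin.zero w (descending w)) ⟩
      ∑ʷ (suc k) (λ w → 𝟙 (fresh Fin.zero w) * H w + occurrences Fin.zero w * H w)
        ≡⟨ ∑ʷ-distrib-+ (suc k) (λ w → 𝟙 (fresh Fin.zero w) * H w) (λ w → occurrences Fin.zero w * H w) ⟩
      ∑ʷ (suc k) (λ w → 𝟙 (fresh Fin.zero w) * H w) + ∑ʷ (suc k) (λ w → occurrences Fin.zero w * H w)
        ≡⟨ cong₂ _+_ (∑ʷ-fresh-descendingCount 0 (suc k) Fin.zero) (∑ʷ-occurrences-descending k Fin.zero) ⟩
      descendingCount 0 (suc k) N + (r ∸ 1) * descendingCount 0 k N ∎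
      where
      open ≡-Reasoning
      H : Word (suc N) (suc k) → ℕ
      H w = 𝟙 (distinct w ∧ descending w)

    descendingCount-overfull : ∀ {k N} → N < k → descendingCount 0 k N ≡ 0
    descendingCount-overfull {suc k} {zero}  _         = refl
    descendingCount-overfull {suc k} {suc N} (s<s N<k) = begin
      descendingCount 0 (suc k) (suc N)                               ≡⟨ descendingCount-pascal k N ⟩
      descendingCount 0 (suc k) N + (r ∸ 1) * descendingCount 0 k N
        ≡⟨ cong₂ (λ a b → a + (r ∸ 1) * b) (descendingCount-overfull (m<n⇒m<1+n N<k)) (descendingCount-overfull N<k) ⟩
      (r ∸ 1) * 0                                                     ≡⟨ *-zeroʳ (r ∸ 1) ⟩
      0                                                               ∎
      where open ≡-Reasoning

    descendingCount-diagonal : ∀ k → descendingCount 0 k k ≡ (r ∸ 1) ^ k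
    descendingCount-diagonal zero    = refl
    descendingCount-diagonal (suc k) = trans (descendingCount-pascal k k)
      (cong₂ (λ a b → a + (r ∸ 1) * b) (descendingCount-overfull (n<1+n k)) (descendingCount-diagonal k))

    descendingCount-prefix : ∀ j k → descendingCount j (j + k) (j + k) * k ! ≡ (j + k) ! * (r ^ j * (r ∸ 1) ^ k)
    descendingCount-prefix zero    k = begin
      descendingCount 0 k k * k !   ≡⟨ cong (_* k !) (descendingCount-diagonal k) ⟩
      (r ∸ 1) ^ k * k !             ≡⟨ *-comm ((r ∸ 1) ^ k) (k !) ⟩
      k ! * (r ∸ 1) ^ k             ≡⟨ cong (k ! *_) (*-identityˡ ((r ∸ 1) ^ k)) ⟨
      k ! * (1 * (r ∸ 1) ^ k)       ∎
      where open ≡-Reasoning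
    descendingCount-prefix (suc j) k = begin
      descendingCount (suc j) (suc n) (suc n) * k !  ≡⟨ cong (_* k !) (descendingCount-suc j n n) ⟩
      suc n * (r * descendingCount j n n) * k !      ≡⟨ regroup (suc n) r (descendingCount j n n) (k !) ⟩
      suc n * (r * (descendingCount j n n * k !))    ≡⟨ cong (λ x → suc n * (r * x)) (descendingCount-prefix j k) ⟩
      suc n * (r * (n ! * (r ^ j * (r ∸ 1) ^ k)))    ≡⟨ shuffle (suc n) r (n !) (r ^ j) ((r ∸ 1) ^ k) ⟩
      (suc n * n !) * ((r * r ^ j) * (r ∸ 1) ^ k)    ∎
      where
      open ≡-Reasoning
      n = j + k
      regroup : ∀ a b c d → a * (b * c) * d ≡ a * (b * (c * d))
      regroup = solve-∀
      shuffle : ∀ a b c d e → a * (b * (c * (d * e))) ≡ (a * c) * ((b * d) * e)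
      shuffle = solve-∀

    descendingCount-full : ∀ n → descendingCount n n n ≡ n ! * r ^ n
    descendingCount-full n = begin
      descendingCount n n n           ≡⟨ *-identityʳ (descendingCount n n n) ⟨
      descendingCount n n n * 0 !
        ≡⟨ subst (λ k → descendingCount n k k * 0 ! ≡ k ! * (r ^ n * 1)) (+-identityʳ n) (descendingCount-prefix n 0) ⟩
      n ! * (r ^ n * 1)               ≡⟨ cong (n ! *_) (*-identityʳ (r ^ n)) ⟩
      n ! * r ^ n                     ∎
      where open ≡-Reasoning

    -- Colored permutations as words

    values : ∀ {N k} → Word N k → Fin k → Fin N
    values w i = proj₁ (lookup w i)

    colors : ∀ {N k} → Word N k → Fin k → Fin r
    colors w i = proj₂ (lookup w i)

    toColPerm : ∀ {n} → Word n n → ColPerm n r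
    toColPerm w = values w , colors w

    values-∷ : ∀ {N k} v c (w : Word N k) → (v ∷ᶠ values w) ≗ values ((v , c) ∷ w)
    values-∷ v c w Fin.zero    = refl
    values-∷ v c w (Fin.suc i) = refl

    colors-∷ : ∀ {N k} v c (w : Word N k) → (c ∷ᶠ colors w) ≗ colors ((v , c) ∷ w)
    colors-∷ v c w Fin.zero    = refl
    colors-∷ v c w (Fin.suc i) = refl

    -- allFuns builds its functions with _∷ᶠ_, and these agree with values and colors of a word only
    -- pointwise.
    Extensional₂ : ∀ {n N} → ((Fin n → Fin N) → (Fin n → Fin r) → ℕ) → Set
    Extensional₂ G = ∀ {ω ω′ τ τ′} → ω ≗ ω′ → τ ≗ τ′ → G ω τ ≡ G ω′ τ′

    sum-allFuns² : ∀ n {N} (G : (Fin n → Fin N) → (Fin n → Fin r) → ℕ) → Extensional₂ G →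
                   sum (map (λ ω → sum (map (G ω) (allFuns n r))) (allFuns n N)) ≡ ∑ʷ n (λ w → G (values w) (colors w))
    sum-allFuns² zero    G G-ext = trans (+-identityʳ _) (trans (+-identityʳ _) (G-ext (λ ()) (λ ())))
    sum-allFuns² (suc n) {N} G G-ext = begin
      sum (map (λ ω → sum (map (G ω) (allFuns (suc n) r))) (allFuns (suc n) N))
        ≡⟨ sum-allFuns-suc n N (λ ω → sum (map (G ω) (allFuns (suc n) r))) ⟩
      ∑[ v < N ] sum (map (λ ω → sum (map (G (v ∷ᶠ ω)) (allFuns (suc n) r))) (allFuns n N))
        ≡⟨ sum-cong-≗ (λ v → cong sum (map-cong (λ ω → sum-allFuns-suc n r (G (v ∷ᶠ ω))) (allFuns n N))) ⟩
      ∑[ v < N ] sum (map (λ ω → ∑[ c < r ] sum (map (λ τ → G (v ∷ᶠ ω) (c ∷ᶠ τ)) (allFuns n r))) (allFuns n N))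
        ≡⟨ sum-cong-≗ (λ v → sum-map-∑ (λ ω c → sum (map (λ τ → G (v ∷ᶠ ω) (c ∷ᶠ τ)) (allFuns n r)))
                                       (allFuns n N)) ⟩
      ∑[ v < N ] ∑[ c < r ] sum (map (λ ω → sum (map (λ τ → G (v ∷ᶠ ω) (c ∷ᶠ τ)) (allFuns n r))) (allFuns n N))
        ≡⟨ sum-cong-≗ (λ v → sum-cong-≗ λ c →
             sum-allFuns² n (λ ω τ → G (v ∷ᶠ ω) (c ∷ᶠ τ))
                            (λ ω≗ω′ τ≗τ′ → G-ext (∷ᶠ-cong ω≗ω′) (∷ᶠ-cong τ≗τ′))) ⟩
      ∑[ v < N ] ∑[ c < r ] ∑ʷ {N} n (λ w → G (v ∷ᶠ values w) (c ∷ᶠ colors w))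
        ≡⟨ sum-cong-≗ (λ v → sum-cong-≗ λ c → ∑ʷ-cong {N} n λ w → G-ext (values-∷ v c w) (colors-∷ v c w)) ⟩
      ∑ʷ (suc n) (λ w → G (values w) (colors w)) ∎
      where
      open ≡-Reasoning
      ∷ᶠ-cong : ∀ {A : Set} {x : A} {f g : Fin n → A} → f ≗ g → (x ∷ᶠ f) ≗ (x ∷ᶠ g)
      ∷ᶠ-cong f≗g Fin.zero    = refl
      ∷ᶠ-cong f≗g (Fin.suc i) = f≗g i

    fresh⇔ : ∀ {N k} (v : Fin N) (w : Word N k) → T (fresh v w) ⇔ (∀ j → v ≢ values w j)
    fresh⇔ v []            = mk⇔ (λ _ ()) _
    fresh⇔ v ((u , _) ∷ w) = mk⇔
      (λ fresh-v → λ { Fin.zero    → T-not-does⁻ (v ≟ u) (proj₁ (to T-∧ fresh-v))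
                     ; (Fin.suc j) → to (fresh⇔ v w) (proj₂ (to T-∧ fresh-v)) j })
      (λ v∉w → from T-∧ (T-not-does⁺ (v ≟ u) (v∉w Fin.zero) , from (fresh⇔ v w) (v∉w ∘ Fin.suc)))

    distinct⇔ : ∀ {N k} (w : Word N k) → T (distinct w) ⇔ (∀ i j → values w i ≡ values w j → i ≡ j)
    distinct⇔ []            = mk⇔ (λ _ ()) _
    distinct⇔ ((u , _) ∷ w) = mk⇔ ⇒ ⇐
      where
      ⇒ : T (fresh u w ∧ distinct w) → _
      ⇒ d Fin.zero    Fin.zero    _ = refl
      ⇒ d Fin.zero    (Fin.suc j) e = contradiction e (to (fresh⇔ u w) (proj₁ (to T-∧ d)) j)
      ⇒ d (Fin.suc i) Fin.zero    e = contradiction (sym e) (to (fresh⇔ u w) (proj₁ (to T-∧ d)) i)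
      ⇒ d (Fin.suc i) (Fin.suc j) e = cong Fin.suc (to (distinct⇔ w) (proj₂ (to T-∧ d)) i j e)
      ⇐ : _ → T (fresh u w ∧ distinct w)
      ⇐ inj = from T-∧ ( from (fresh⇔ u w) (λ j e → 0≢1+n (inj Fin.zero (Fin.suc j) e))
                       , from (distinct⇔ w) (λ i j e → Fin-suc-injective (inj (Fin.suc i) (Fin.suc j) e)))

    isPerm?-values : ∀ {n} (w : Word n n) → does (isPerm? (values w)) ≡ distinct w
    isPerm?-values w = sym (does-⇔ (distinct⇔ w) (T? (distinct w)) (isPerm? (values w)))

    sum-allColPerms : ∀ n (F : ColPerm n r → ℕ) → Extensional₂ (λ ω τ → F (ω , τ)) →
                      sum (map F (allColPerms n r)) ≡ ∑ʷ n (λ w → 𝟙 (distinct w) * F (toColPerm w))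
    sum-allColPerms n F F-ext = begin
      sum (map F (concatMap (λ ω → map (ω ,_) (allFuns n r)) (allPerms n)))
        ≡⟨ sum-map-concatMap F (λ ω → map (ω ,_) (allFuns n r)) (allPerms n) ⟩
      sum (map (λ ω → sum (map F (map (ω ,_) (allFuns n r)))) (filter isPerm? (allFuns n n)))
        ≡⟨ sum-map-filter isPerm? (λ ω → sum (map F (map (ω ,_) (allFuns n r)))) (allFuns n n) ⟩
      sum (map (λ ω → 𝟙 (does (isPerm? ω)) * sum (map F (map (ω ,_) (allFuns n r)))) (allFuns n n))
        ≡⟨ cong sum (map-cong (λ ω → trans (cong (λ s → 𝟙 (does (isPerm? ω)) * sum s) (sym (map-∘ (allFuns n r))))
                                           (*-distribˡ-sum-map (𝟙 (does (isPerm? ω))) (λ τ → F (ω , τ)) (allFuns n r)))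
                               (allFuns n n)) ⟩
      sum (map (λ ω → sum (map (λ τ → 𝟙 (does (isPerm? ω)) * F (ω , τ)) (allFuns n r))) (allFuns n n))
        ≡⟨ sum-allFuns² n (λ ω τ → 𝟙 (does (isPerm? ω)) * F (ω , τ))
                          (λ ω≗ω′ τ≗τ′ → cong₂ _*_ (cong 𝟙 (isPerm?-cong ω≗ω′)) (F-ext ω≗ω′ τ≗τ′)) ⟩
      ∑ʷ n (λ w → 𝟙 (does (isPerm? (values w))) * F (toColPerm w))
        ≡⟨ ∑ʷ-cong n (λ w → cong (λ b → 𝟙 b * F (toColPerm w)) (isPerm?-values w)) ⟩
      ∑ʷ n (λ w → 𝟙 (distinct w) * F (toColPerm w)) ∎
      where open ≡-Reasoning

    symbolAt : ∀ {N k} → Word N k → ℕ → ℕ × ℕ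
    symbolAt {N} []      _       = suc N , 0
    symbolAt     (a ∷ _) zero    = symbol a
    symbolAt     (_ ∷ w) (suc q) = symbolAt w q

    symbolAt-lookup : ∀ {N k} (w : Word N k) q (q<k : q < k) → symbolAt w q ≡ symbol (lookup w (fromℕ< q<k))
    symbolAt-lookup (a ∷ w) zero    _         = refl
    symbolAt-lookup (a ∷ w) (suc q) (s<s q<k) = symbolAt-lookup w q q<k

    symbolAt-beyond : ∀ {N k} (w : Word N k) q → ¬ q < k → symbolAt w q ≡ (suc N , 0)
    symbolAt-beyond []      q       _   = refl
    symbolAt-beyond (a ∷ w) zero    q≮k = contradiction (s<s z≤n) q≮k
    symbolAt-beyond (a ∷ w) (suc q) q≮k = symbolAt-beyond w q (q≮k ∘ s<s)

    letter-toColPerm : ∀ {n} (w : Word n n) q → letter (toColPerm w) q ≡ symbolAt w q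
    letter-toColPerm {n} w q with q <ℕ? n
    ... | yes q<n = sym (symbolAt-lookup w q q<n)
    ... | no  q≮n = sym (symbolAt-beyond w q q≮n)

    >ₛ-sentinel : ∀ {N} (a : Letter N) → does (symbol a >ₛ? (suc N , 0)) ≡ does (0 <ℕ? toℕ (proj₂ a))
    >ₛ-sentinel (v , c) = does-⇔ (mk⇔ above inj₁) (symbol (v , c) >ₛ? _) (0 <ℕ? toℕ c)
      where
      above : symbol (v , c) >ₛ _ → 0 < toℕ c
      above (inj₁ 0<c)            = 0<c
      above (inj₂ (_ , N+1<v+1)) = contradiction (s<s⁻¹ N+1<v+1) (<-asym (toℕ<n v))

    descentAt : ∀ {N k} → Word N k → ℕ → ℕ
    descentAt w q = 𝟙 (does (symbolAt w q >ₛ? symbolAt w (suc q)))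

    product-descentAt : ∀ {N k} (w : Word N k) → product (applyUpTo (descentAt w) k) ≡ 𝟙 (descending w)
    product-descentAt []          = refl
    product-descentAt (a ∷ [])    = trans (*-identityʳ _) (cong 𝟙 (>ₛ-sentinel a))
    product-descentAt (a ∷ b ∷ w) =
      trans (cong (descentAt (a ∷ b ∷ w) 0 *_) (product-descentAt (b ∷ w))) (sym (𝟙-∧ (does (a ≻? b)) _))

    product-descentAt-from : ∀ {N k} m (w : Word N k) →
                             product (applyUpTo (λ j → descentAt w (m + j)) (k ∸ m)) ≡ 𝟙 (descendingFrom m w)
    product-descentAt-from zero    w       = product-descentAt w
    product-descentAt-from (suc m) []      = refl
    product-descentAt-from (suc m) (_ ∷ w) = product-descentAt-from m w

    prodX-toColPerm : ∀ {n} m (w : Word n n) → prodX (suc m) n (toColPerm w) ≡ 𝟙 (descendingFrom m w)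
    prodX-toColPerm {n} m w = begin
      product (map (λ j → X (suc m + j) (toColPerm w)) (upTo (n ∸ m)))
        ≡⟨ cong product (map-cong (λ j → trans (X≡𝟙 (suc m + j) (toColPerm w))
             (cong₂ (λ x y → 𝟙 (does (x >ₛ? y))) (letter-toColPerm w (m + j)) (letter-toColPerm w (suc m + j))))
             (upTo (n ∸ m))) ⟩
      product (map (λ j → descentAt w (m + j)) (upTo (n ∸ m)))
        ≡⟨ cong product (map-applyUpTo (λ j → descentAt w (m + j)) (λ i → i) (n ∸ m)) ⟩
      product (applyUpTo (λ j → descentAt w (m + j)) (n ∸ m))
        ≡⟨ product-descentAt-from m w ⟩
      𝟙 (descendingFrom m w) ∎
      where open ≡-Reasoning

    descendingFrom-length : ∀ {N k} (w : Word N k) → descendingFrom k w ≡ true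
    descendingFrom-length []      = refl
    descendingFrom-length (_ ∷ w) = descendingFrom-length w

    sum-prodX : ∀ m n → sum (map (prodX (suc m) n) (allColPerms n r)) ≡ descendingCount m n n
    sum-prodX m n = trans (sum-allColPerms n (prodX (suc m) n) (prodX-cong (suc m) n))
      (∑ʷ-cong n λ w → trans (cong (𝟙 (distinct w) *_) (prodX-toColPerm m w)) (sym (𝟙-∧ (distinct w) _)))

    length-allColPerms : ∀ n → length (allColPerms n r) ≡ descendingCount n n n
    length-allColPerms n = begin
      length (allColPerms n r)                               ≡⟨ length≡sum-map-1 (allColPerms n r) ⟩
      sum (map (λ _ → 1) (allColPerms n r))                  ≡⟨ sum-allColPerms n (λ _ → 1) (λ _ _ → refl) ⟩
      ∑ʷ n (λ w → 𝟙 (distinct w) * 1)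
        ≡⟨ ∑ʷ-cong n (λ w → trans (*-identityʳ (𝟙 (distinct w)))
                                  (cong 𝟙 (sym (trans (cong (distinct w ∧_) (descendingFrom-length w))
                                                      (∧-identityʳ (distinct w)))))) ⟩
      descendingCount n n n                                  ∎
      where open ≡-Reasoning

  -- The expectation

  average-≡ : ∀ {A : Set} (xs : List A) (f : A → ℕ) L .{{_ : NonZero L}} →
              length xs ≡ L → average xs f ≡ (+ sum (map f xs)) / L
  average-≡ xs f (suc L) eq with length xs | eq
  ... | .(suc L) | refl = refl

  /-cross : ∀ a b c d .{{_ : NonZero b}} .{{_ : NonZero d}} → a * d ≡ c * b → (+ a) / b ≡ (+ c) / d
  /-cross a (suc b) c (suc d) eq =
    fromℚᵘ-cong {mkℚᵘ (+ a) b} {mkℚᵘ (+ c) d}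
                (*≡* (trans (sym (pos-* a (suc d))) (trans (cong +_ eq) (pos-* c (suc b)))))

  /-*-/ : ∀ a b c d .{{_ : NonZero b}} .{{_ : NonZero d}} →
          ((+ a) / b) *ℚ ((+ c) / d) ≡ ((+ (a * c)) / (b * d)) {{m*n≢0 b d}}
  -- mkℚᵘ n k has denominator suc k, and suc b * suc d = suc (d + b * suc d).
  /-*-/ a (suc b) c (suc d) = toℚᵘ-injective (begin
    toℚᵘ ((+ a / suc b) *ℚ (+ c / suc d))
      ≈⟨ toℚᵘ-homo-* (+ a / suc b) (+ c / suc d) ⟩
    toℚᵘ (+ a / suc b) *ᵘ toℚᵘ (+ c / suc d)
      ≈⟨ *ᵘ-cong (toℚᵘ-fromℚᵘ (mkℚᵘ (+ a) b)) (toℚᵘ-fromℚᵘ (mkℚᵘ (+ c) d)) ⟩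
    mkℚᵘ (+ a) b *ᵘ mkℚᵘ (+ c) d
      ≈⟨ *≡* (cong (ℤ._* + suc (d + b * suc d)) (sym (pos-* a c))) ⟩
    mkℚᵘ (+ (a * c)) (d + b * suc d)
      ≈⟨ toℚᵘ-fromℚᵘ (mkℚᵘ (+ (a * c)) (d + b * suc d)) ⟨
    toℚᵘ (+ (a * c) / (suc b * suc d)) ∎)
    where open ≃-Reasoning

  /-^ℚ : ∀ a b k .{{nb : NonZero b}} → ((+ a) / b) ^ℚ k ≡ ((+ (a ^ k)) / (b ^ k)) {{m^n≢0 b k}}
  /-^ℚ a b zero    = refl
  /-^ℚ a b (suc k) {{nb}} = trans (cong ((+ a / b) *ℚ_) (/-^ℚ a b k)) (/-*-/ a b (a ^ k) (b ^ k) {{nb}} {{m^n≢0 b k}})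

  𝔼-prodX : ∀ r .{{_ : NonZero r}} m d {n} → m + d ≡ n →
            𝔼 n r (prodX (suc m) n) ≡ (((+ (r ∸ 1)) / r) ^ℚ d) *ℚ ((+ 1) / (d !)) {{d !≢0}}
  𝔼-prodX r m d refl = begin
    average (allColPerms n r) (prodX (suc m) n)
      ≡⟨ average-≡ (allColPerms n r) (prodX (suc m) n) (n ! * r ^ n) length-n!r^n ⟩
    (+ S) / (n ! * r ^ n)
      ≡⟨ /-cross S (n ! * r ^ n) ((r ∸ 1) ^ d * 1) (r ^ d * d !) cross ⟩
    (+ ((r ∸ 1) ^ d * 1)) / (r ^ d * d !)
      ≡⟨ /-*-/ ((r ∸ 1) ^ d) (r ^ d) 1 (d !) ⟨
    ((+ (r ∸ 1) ^ d) / r ^ d) *ℚ ((+ 1) / d !)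
      ≡⟨ cong (_*ℚ ((+ 1) / d !)) (/-^ℚ (r ∸ 1) r d) ⟨
    (((+ (r ∸ 1)) / r) ^ℚ d) *ℚ ((+ 1) / (d !)) ∎
    where
    open ≡-Reasoning
    n = m + d
    S = sum (map (prodX (suc m) n) (allColPerms n r))
    instance
      _ = d !≢0
      _ = m^n≢0 r d
      _ = m^n≢0 r n
      _ = m*n≢0 (n !) (r ^ n) {{n !≢0}}
      _ = m*n≢0 (r ^ d) (d !)
    length-n!r^n : length (allColPerms n r) ≡ n ! * r ^ n
    length-n!r^n = trans (length-allColPerms r n) (descendingCount-full r n)
    S*d! : S * d ! ≡ n ! * (r ^ m * (r ∸ 1) ^ d)
    S*d! = trans (cong (_* d !) (sum-prodX r m n)) (descendingCount-prefix r m d)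
    cross : S * (r ^ d * d !) ≡ (r ∸ 1) ^ d * 1 * (n ! * r ^ n)
    cross = begin
      S * (r ^ d * d !)                       ≡⟨ swap-last S (r ^ d) (d !) ⟩
      (S * d !) * r ^ d                       ≡⟨ cong (_* r ^ d) S*d! ⟩
      n ! * (r ^ m * (r ∸ 1) ^ d) * r ^ d     ≡⟨ collect (n !) (r ^ m) ((r ∸ 1) ^ d) (r ^ d) ⟩
      (r ∸ 1) ^ d * 1 * (n ! * (r ^ m * r ^ d)) ≡⟨ cong (λ x → (r ∸ 1) ^ d * 1 * (n ! * x)) (^-distribˡ-+-* r m d) ⟨
      (r ∸ 1) ^ d * 1 * (n ! * r ^ n)         ∎
      where
      swap-last : ∀ a b c → a * (b * c) ≡ a * c * b
      swap-last = solve-∀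
      collect : ∀ a b c e → a * (b * c) * e ≡ c * 1 * (a * (b * e))
      collect = solve-∀

open import Data.Nat using (ℕ; suc; _≤_; _<_; _∸_; _!; NonZero)
open import Data.Nat.Properties using (_!≢0; m+[n∸m]≡n; <⇒≤)
open import Data.Integer using (+_)
open import Data.Rational using (ℚ; _/_; _*_)
open import Relation.Binary.PropositionalEquality using (_≡_)

lemma3p5 : (m n r : ℕ) → .{{_ : NonZero r}} → 1 ≤ m → m < n →
    𝔼 n r (prodX (suc m) n) ≡ (((+ (r ∸ 1)) / r) ^ℚ (n ∸ m)) * ((+ 1) / ((n ∸ m) !)) {{(n ∸ m) !≢0}}
lemma3p5 m n r _ m<n = Counting.𝔼-prodX r m (n ∸ m) (m+[n∸m]≡n (<⇒≤ m<n))
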